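{- Let $(T,\eta,(-)^\dagger)$ be a monad on $\mathbf{Cont}$ and let $\mathsf{c}:\langle\!\langle-\rangle\!\rangle\to\langle\!\langle T(-)\rangle\!\rangle$ be the structure map of a right $T$-comodule with carrier $\langle\!\langle-\rangle\!\rangle$. Call a map $F:\langle\!\langle A\triangleleft P\rangle\!\rangle\to\langle\!\langle B\triangleleft Q\rangle\!\rangle$ representable if there exists a container morphism $\tau\triangleleft e:B\triangleleft Q\to T(A\triangleleft P)$ with $F=\langle\!\langle\tau\triangleleft e\rangle\!\rangle\circ\mathsf{c}_{A\triangleleft P}$. Then for every container $A\triangleleft P$ the identity map on $\langle\!\langle A\triangleleft P\rangle\!\rangle$ is representable, and if $F:\langle\!\langle A\triangleleft P\rangle\!\rangle\to\langle\!\langle B\triangleleft Q\rangle\!\rangle$ and $G:\langle\!\langle B\triangleleft Q\rangle\!\rangle\to\langle\!\langle C\triangleleft R\rangle\!\rangle$ are representable then so is $G\circ F$. Hence the representable functionals form a subcategory $\mathbf{RFun}(T,\langle\!\langle-\rangle\!\rangle,\mathsf{c})$ of the category $\mathbf{Fun}$ whose objects are containers and whose morphisms $A\triangleleft P\to B\triangleleft Q$ are all maps $\langle\!\langle A\triangleleft P\rangle\!\rangle\to\langle\!\langle B\triangleleft Q\rangle\!\rangle$.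
   Context: Work in extensional Martin-Löf type theory. $\mathbf{Cont}$ is the category of containers $A\triangleleft P$ ($A$ a type, $P:A\to\mathbf{Type}$) with morphisms $f\triangleleft g:A\triangleleft P\to B\triangleleft Q$ given by $f:A\to B$ and $g:\prod_{\{a:A\}}(Q\,(f\,a)\to P\,a)$, composition $(k\triangleleft l)\circ(f\triangleleft g)=(k\circ f)\triangleleft(\lambda\{a\}.\,g\{a\}\circ l\{f\,a\})$. The functor $\langle\!\langle-\rangle\!\rangle:\mathbf{Cont}^{\mathrm{op}}\to\mathbf{Type}$ is $\langle\!\langle A\triangleleft P\rangle\!\rangle=\prod_{a:A}P\,a$, and for $f\triangleleft g:A\triangleleft P\to B\triangleleft Q$, $\langle\!\langle f\triangleleft g\rangle\!\rangle\,\alpha=\lambda a.\,g\{a\}(\alpha(f\,a))$. A right $T$-comodule structure map on $\langle\!\langle-\rangle\!\rangle$ is a natural transformation $\mathsf{c}:\langle\!\langle-\rangle\!\rangle\to\langle\!\langle T(-)\rangle\!\rangle$ (naturality: $\langle\!\langle Tk\rangle\!\rangle\circ\mathsf{c}_Y=\mathsf{c}_X\circ\langle\!\langle k\rangle\!\rangle$ for $k:X\to Y$) such that $\langle\!\langle\eta_X\rangle\!\rangle\circ\mathsf{c}_X=\mathrm{id}$ and $\mathsf{c}_{TX}\circ\mathsf{c}_X=\langle\!\langle\mu_X\rangle\!\rangle\circ\mathsf{c}_X$, where $\mu_X=(\mathrm{id}_{TX})^\dagger$ and $Tk=(\eta\circ k)^\dagger$. -}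

module Defs where

open import Level using (Level)
open import Data.Product using (Σ; _×_; _,_)
open import Function using (_∘_; id)
open import Relation.Binary.PropositionalEquality using (_≡_)

record Cont : Set₁ where
  constructor _◁_
  field
    Sh  : Set
    Pos : Sh → Set
open Cont public

record Hom (X Y : Cont) : Set where
  constructor _◁ₘ_
  field
    shape : Sh X → Sh Y
    pos   : ∀ {a : Sh X} → Pos Y (shape a) → Pos X a
open Hom public

idC : (X : Cont) → Hom X X
idC X = (λ a → a) ◁ₘ (λ {a} p → p)

_∘C_ : {X Y Z : Cont} → Hom Y Z → Hom X Y → Hom X Z
(k ◁ₘ l) ∘C (f ◁ₘ g) = (λ a → k (f a)) ◁ₘ (λ {a} q → g {a} (l {f a} q))

⟪_⟫ : Cont → Set
⟪ A ◁ P ⟫ = (a : A) → P a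

⟪_⟫₁ : {X Y : Cont} → Hom X Y → ⟪ Y ⟫ → ⟪ X ⟫
⟪ f ◁ₘ g ⟫₁ α = λ a → g {a} (α (f a))

record Monad : Set₁ where
  field
    T     : Cont → Cont
    η     : (X : Cont) → Hom X (T X)
    _†    : {X Y : Cont} → Hom X (T Y) → Hom (T X) (T Y)
    unitˡ : (X : Cont) → η X † ≡ idC (T X)
    unitʳ : {X Y : Cont} (f : Hom X (T Y)) → (f †) ∘C η X ≡ f
    assoc : {X Y Z : Cont} (f : Hom X (T Y)) (g : Hom Y (T Z)) →
            ((g †) ∘C f) † ≡ (g †) ∘C (f †)

  μ : (X : Cont) → Hom (T (T X)) (T X)
  μ X = idC (T X) †

  Tₘ : {X Y : Cont} → Hom X Y → Hom (T X) (T Y)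
  Tₘ {X} {Y} k = (η Y ∘C k) †

record Comodule (M : Monad) : Set₁ where
  open Monad M
  field
    c       : (X : Cont) → ⟪ X ⟫ → ⟪ T X ⟫
    natural : {X Y : Cont} (k : Hom X Y) → (⟪ Tₘ k ⟫₁ ∘ c Y) ≡ (c X ∘ ⟪ k ⟫₁)
    counit  : (X : Cont) → (⟪ η X ⟫₁ ∘ c X) ≡ id
    coassoc : (X : Cont) → (c (T X) ∘ c X) ≡ (⟪ μ X ⟫₁ ∘ c X)

Representable : (M : Monad) (C : Comodule M) {X Y : Cont} → (⟪ X ⟫ → ⟪ Y ⟫) → Set
Representable M C {X} {Y} F =
  Σ (Hom Y (Monad.T M X)) λ τe → F ≡ (⟪ τe ⟫₁ ∘ Comodule.c C X)

-- The identity is represented by the unit η, by the counit law. If F and G are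
-- represented by f : Y → T X and g : Z → T Y, then naturality of c moves ⟪ f ⟫
-- past c, and coassociativity turns the doubled c into ⟪ μ ⟫ ∘ c, so G ∘ F is
-- represented by μ ∘ T f ∘ g, i.e. by the Kleisli composite of f and g.
module Submission where

open import Defs
open import Data.Product using (_×_; _,_)
open import Function using (_∘_; id)
open import Relation.Binary.PropositionalEquality using (_≡_; refl; sym; cong; module ≡-Reasoning)

⟪⟫₁-∘C : {X Y Z : Cont} (g : Hom Y Z) (f : Hom X Y) → ⟪ g ∘C f ⟫₁ ≡ ⟪ f ⟫₁ ∘ ⟪ g ⟫₁
⟪⟫₁-∘C g f = refl

module Representability (M : Monad) (C : Comodule M) where
  open Monad M
  open Comodule C
  open ≡-Reasoning

  id-representable : (X : Cont) → Representable M C {X} {X} id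
  id-representable X = η X , sym (counit X)

  represented-∘ : {X Y Z : Cont} (f : Hom Y (T X)) (g : Hom Z (T Y)) →
            ⟪ g ⟫₁ ∘ c Y ∘ ⟪ f ⟫₁ ∘ c X ≡ ⟪ μ X ∘C (Tₘ f ∘C g) ⟫₁ ∘ c X
  represented-∘ {X} {Y} f g = begin
    ⟪ g ⟫₁ ∘ c Y ∘ ⟪ f ⟫₁ ∘ c X           ≡⟨ cong (λ h → ⟪ g ⟫₁ ∘ h ∘ c X) (sym (natural f)) ⟩
    ⟪ g ⟫₁ ∘ ⟪ Tₘ f ⟫₁ ∘ c (T X) ∘ c X     ≡⟨ cong (λ h → ⟪ g ⟫₁ ∘ ⟪ Tₘ f ⟫₁ ∘ h) (coassoc X) ⟩
    ⟪ g ⟫₁ ∘ ⟪ Tₘ f ⟫₁ ∘ ⟪ μ X ⟫₁ ∘ c X    ≡⟨ cong (_∘ c X) (sym (⟪⟫₁-∘C (μ X) (Tₘ f ∘C g))) ⟩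
    ⟪ μ X ∘C (Tₘ f ∘C g) ⟫₁ ∘ c X         ∎

  ∘-representable : {X Y Z : Cont} (F : ⟪ X ⟫ → ⟪ Y ⟫) (G : ⟪ Y ⟫ → ⟪ Z ⟫) →
                    Representable M C F → Representable M C G → Representable M C (G ∘ F)
  ∘-representable F G (f , refl) (g , refl) = μ _ ∘C (Tₘ f ∘C g) , represented-∘ f g

theorem6 : (M : Monad) (C : Comodule M) →
    ((X : Cont) → Representable M C {X} {X} id)
    × ({X Y Z : Cont} (F : ⟪ X ⟫ → ⟪ Y ⟫) (G : ⟪ Y ⟫ → ⟪ Z ⟫) →
    Representable M C F → Representable M C G → Representable M C (G ∘ F))
theorem6 M C = id-representable , ∘-representable
  where open Representability M C
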